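{- Let $q\ge1$ be an integer and $\beta$ a constant. Let $G$ be a finite connected graph with an interaction energy $J_e$ on each edge $e$ and a magnetic field vector $\boldsymbol{M}_i=(M_{i,1},\dots,M_{i,q})\in\mathbb{C}^q$ at each vertex $v_i$, and let $Z(G)=\sum_{\sigma}\mathrm{e}^{ -\beta h(\sigma)}$ with \[h(\sigma)=-\sum_{e=\{v_i,v_j\}\in E(G)}J_{e}\,\delta(\sigma_i,\sigma_j)-\sum_{v_i\in V(G)}\sum_{\alpha=1}^q M_{i,\alpha}\,\delta(\alpha,\sigma_i).\] Then $Z(G)$ is a polynomial (with integer coefficients) in the variables $\{\boldsymbol{v},X_{\boldsymbol{M}}\mid\boldsymbol{M}\in\mathcal{M}\}$, where $\boldsymbol{v}=\{\mathrm{e}^{\beta J_e}-1\}_{e\in E(G)}$, $X_{\boldsymbol{M}}=\sum_{\alpha=1}^q\mathrm{e}^{\beta M_\alpha}$ for $\boldsymbol{M}=(M_1,\dots,M_q)$, and $\mathcal{M}=\{\sum_{i=1}^{|V(G)|}\varepsilon_i\boldsymbol{M}_i\mid \varepsilon_i\in\{0,1\}\}$.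
   Context: Graphs are finite, loops and multiple edges allowed. A state is a map $\sigma:V(G)\to\{1,\dots,q\}$, $\sigma_i=\sigma(v_i)$; $Z$ sums over all states; $\delta$ is the Kronecker delta. -}

module Defs where

open import Level using (0ℓ)
open import Data.Nat using (ℕ; zero; suc)
open import Data.Fin using (Fin; _≟_)
open import Data.Bool using (Bool; true; false; if_then_else_)
open import Data.Product using (_×_; _,_; proj₁; proj₂)
open import Data.Sum using (_⊎_; inj₁; inj₂)
open import Data.Vec using (Vec; lookup)
open import Data.Vec.Functional using (_∷_; [])
open import Relation.Nullary using (does)
open import Algebra.Bundles using (CommutativeRing)

-- A finite multigraph with loops allowed: vertices v_0..v_{n-1} = Fin n,
-- edges Fin m, each edge given by its pair of endpoints (orientation irrelevant).
record Graph : Set where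
  field
    n    : ℕ
    m    : ℕ
    ends : Fin m → Fin n × Fin n
open Graph public

data Adj (G : Graph) : Fin (n G) → Fin (n G) → Set where
  along   : (e : Fin (m G)) → Adj G (proj₁ (ends G e)) (proj₂ (ends G e))
  against : (e : Fin (m G)) → Adj G (proj₂ (ends G e)) (proj₁ (ends G e))

data Reach (G : Graph) : Fin (n G) → Fin (n G) → Set where
  here : ∀ {i} → Reach G i i
  step : ∀ {i j k} → Adj G i j → Reach G j k → Reach G i k

Connected : Graph → Set
Connected G = ∀ i j → Reach G i j

-- Integer-coefficient polynomial expressions in variables of type X.
data Poly (X : Set) : Set where
  var  : X → Poly X
  zero′ one′ : Poly X
  neg  : Poly X → Poly X
  _⊕_ _⊗_ : Poly X → Poly X → Poly X

-- Variables of Corollary 4.4: v_e for each edge e, and X_S for each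
-- subset S ⊆ V(G) (S given by its indicator ε ∈ {0,1}^n, i.e. M = Σ ε_i M_i).
PVar : Graph → Set
PVar G = Fin (m G) ⊎ Vec Bool (n G)

module _ (R : CommutativeRing 0ℓ 0ℓ) where
  open CommutativeRing R

  eval : {X : Set} → (X → Carrier) → Poly X → Carrier
  eval ρ (var x)   = ρ x
  eval ρ zero′     = 0#
  eval ρ one′      = 1#
  eval ρ (neg p)   = - eval ρ p
  eval ρ (p ⊕ p′)  = eval ρ p + eval ρ p′
  eval ρ (p ⊗ p′)  = eval ρ p * eval ρ p′

  sumFin : (k : ℕ) → (Fin k → Carrier) → Carrier
  sumFin zero    f = 0#
  sumFin (suc k) f = f Fin.zero + sumFin k (λ i → f (Fin.suc i))
    where import Data.Fin as Fin

  prodFin : (k : ℕ) → (Fin k → Carrier) → Carrier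
  prodFin zero    f = 1#
  prodFin (suc k) f = f Fin.zero * prodFin k (λ i → f (Fin.suc i))
    where import Data.Fin as Fin

  sumStates : (k q : ℕ) → ((Fin k → Fin q) → Carrier) → Carrier
  sumStates zero    q f = f []
  sumStates (suc k) q f = sumFin q (λ a → sumStates k q (λ σ → f (a ∷ σ)))

  -- Partition function. w e plays e^{βJ_e}, y i α plays e^{βM_{i,α}};
  -- e^{-βh(σ)} = Π_e (e^{βJ_e})^{δ(σ_i,σ_j)} · Π_i Π_α (e^{βM_{i,α}})^{δ(α,σ_i)}
  --            = Π_e (if σ_i = σ_j then w e else 1) · Π_i y i σ_i.
  Z : (G : Graph) (q : ℕ) → (Fin (m G) → Carrier) → (Fin (n G) → Fin q → Carrier) → Carrier
  Z G q w y = sumStates (n G) q λ σ →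
      prodFin (m G) (λ e → if does (σ (proj₁ (ends G e)) ≟ σ (proj₂ (ends G e))) then w e else 1#)
    * prodFin (n G) (λ i → y i (σ i))

  vVar : (G : Graph) → (Fin (m G) → Carrier) → Fin (m G) → Carrier
  vVar G w e = w e - 1#

  -- X_M for M = Σ ε_i M_i : Σ_α e^{β Σ_i ε_i M_{i,α}} = Σ_α Π_{i : ε_i = 1} y i α.
  XVar : (G : Graph) (q : ℕ) → (Fin (n G) → Fin q → Carrier) → Vec Bool (n G) → Carrier
  XVar G q y ε = sumFin q (λ α → prodFin (n G) (λ i → if lookup ε i then y i α else 1#))

  valuation : (G : Graph) (q : ℕ) → (Fin (m G) → Carrier) → (Fin (n G) → Fin q → Carrier) → PVar G → Carrier
  valuation G q w y (inj₁ e) = vVar G w e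
  valuation G q w y (inj₂ ε) = XVar G q y ε

module Submission where

-- Z(G) is a polynomial in the v_e and X_M by deletion–contraction, i.e. the
-- Fortuin–Kasteleyn expansion carried out one edge at a time.
--
-- We generalise Z to contractions of G: the spins live on k blocks, vertex i of
-- G carries the spin of its block g i, and the remaining edges join blocks (each
-- remembers the edge e of G it came from).  Writing e^{βJ_e} = 1 + v_e, the
-- factor of an edge between blocks a, b is 1 + v_e·δ(σ_a, σ_b), hence
--   Z(contraction) = Z(edge deleted) + v_e · Z(blocks a and b glued, edge deleted).
-- When no edges are left the state sum factorises over blocks, and block B
-- contributes Σ_α Π_{i ∈ B} e^{βM_{i,α}} = X_M with M = Σ_{i ∈ B} M_i.

open import Defs
open import Level using (0ℓ)
open import Data.Nat using (ℕ; _≤_; zero; suc)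
open import Data.Fin using (Fin; zero; suc; _≟_; punchOut)
open import Data.Fin.Properties using (punchIn-punchOut)
open import Data.Product using (Σ; _,_; _×_; proj₁; proj₂)
open import Data.Sum using (inj₁; inj₂)
open import Data.Bool using (Bool; true; false; if_then_else_)
open import Data.Vec using (Vec; tabulate)
open import Data.Vec.Properties using (lookup∘tabulate)
open import Data.Vec.Functional using (Vector; _∷_; []; insertAt; tail; map)
open import Data.Vec.Functional.Properties using (insertAt-lookup; insertAt-punchIn)
open import Function using (id; _∘_)
open import Relation.Nullary using (does; yes; no)
open import Relation.Nullary.Decidable using (dec-true)
open import Relation.Binary.PropositionalEquality as ≡ using (_≡_; _≗_)
open import Algebra.Bundles using (CommutativeMonoid; CommutativeRing)

-- A fold obeying the recursion equations of a finite sum in a commutative monoid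
-- (as sumFin and prodFin of Defs do by definition) agrees with the library's
-- sum; this transfers the library's algebra of finite sums to it.
module Folds {c ℓ} (M : CommutativeMonoid c ℓ)
  (fold : (k : ℕ) → (Fin k → CommutativeMonoid.Carrier M) → CommutativeMonoid.Carrier M)
  (fold-zero : ∀ f → fold zero f ≡ CommutativeMonoid.ε M)
  (fold-suc : ∀ k f → fold (suc k) f ≡ CommutativeMonoid._∙_ M (f zero) (fold k (f ∘ suc))) where
  open CommutativeMonoid M
  open import Algebra.Properties.CommutativeMonoid.Sum M
    using (sum; sum-cong-≋; sum-cong-≗; sum-replicate-zero; ∑-distrib-+; ∑-comm)
  open import Relation.Binary.Reasoning.Setoid setoid

  ≡sum : ∀ {k} (f : Fin k → Carrier) → fold k f ≡ sum f
  ≡sum {zero}  f = fold-zero f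
  ≡sum {suc k} f = ≡.trans (fold-suc k f) (≡.cong (f zero ∙_) (≡sum (f ∘ suc)))

  ≡sum² : ∀ {a b} (f : Fin a → Fin b → Carrier) →
    fold a (λ i → fold b (f i)) ≡ sum (λ i → sum (f i))
  ≡sum² f = ≡.trans (≡sum _) (sum-cong-≗ (λ i → ≡sum (f i)))

  cong : ∀ k {f g : Fin k → Carrier} → (∀ i → f i ≈ g i) → fold k f ≈ fold k g
  cong _ {f} {g} f≈g = begin
    fold _ f ≡⟨ ≡sum f ⟩
    sum f    ≈⟨ sum-cong-≋ f≈g ⟩
    sum g    ≡⟨ ≡sum g ⟨
    fold _ g ∎

  distrib : ∀ k (f g : Fin k → Carrier) → fold k (λ i → f i ∙ g i) ≈ fold k f ∙ fold k g
  distrib _ f g = begin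
    fold _ (λ i → f i ∙ g i) ≡⟨ ≡sum _ ⟩
    sum (λ i → f i ∙ g i)    ≈⟨ ∑-distrib-+ f g ⟩
    sum f ∙ sum g            ≡⟨ ≡.cong₂ _∙_ (≡sum f) (≡sum g) ⟨
    fold _ f ∙ fold _ g      ∎

  swap : ∀ a b (f : Fin a → Fin b → Carrier) →
    fold a (λ i → fold b (f i)) ≈ fold b (λ j → fold a (λ i → f i j))
  swap _ _ f = begin
    fold _ (λ i → fold _ (f i))           ≡⟨ ≡sum² f ⟩
    sum (λ i → sum (f i))                 ≈⟨ ∑-comm f ⟩
    sum (λ j → sum (λ i → f i j))         ≡⟨ ≡sum² (λ j i → f i j) ⟨
    fold _ (λ j → fold _ (λ i → f i j))   ∎

  select : ∀ {k} (c : Fin k) (h : Fin k → Carrier) →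
    fold k (λ x → if does (c ≟ x) then h x else ε) ≈ h c
  select c h = trans (reflexive (≡sum _)) (sum-select c h)
    where
    sum-select : ∀ {k} (c : Fin k) (h : Fin k → Carrier) →
      sum (λ x → if does (c ≟ x) then h x else ε) ≈ h c
    sum-select {suc k} zero    h = trans (∙-congˡ (sum-replicate-zero k)) (identityʳ (h zero))
    sum-select {suc k} (suc c) h = trans (identityˡ _) (sum-select c (h ∘ suc))

insertAt-map : ∀ {A B : Set} {k} (f : A → B) (xs : Vector A k) (b : Fin (suc k)) (x : A) →
  insertAt (f ∘ xs) b (f x) ≗ f ∘ insertAt xs b x
insertAt-map         f xs zero    x zero    = ≡.refl
insertAt-map         f xs zero    x (suc j) = ≡.refl
insertAt-map {k = suc k} f xs (suc b) x zero    = ≡.refl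
insertAt-map {k = suc k} f xs (suc b) x (suc j) = insertAt-map f (tail xs) b x j

-- Gluing block b onto block a′ of the remaining k blocks.
merge : ∀ {k} → Fin (suc k) → Fin k → Fin (suc k) → Fin k
merge b a′ = insertAt id b a′

glue : ∀ {k} (a b : Fin k) → Σ ℕ (λ k′ → Fin k → Fin k′)
glue {suc k} a b with a ≟ b
... | yes _  = suc k , id
... | no a≢b = k , merge b (punchOut (a≢b ∘ ≡.sym))

module StateSums (R : CommutativeRing 0ℓ 0ℓ) (q : ℕ) where
  open CommutativeRing R hiding (zero)
  open import Algebra.Properties.Semiring.Sum semiring using (*-distribˡ-sum; *-distribʳ-sum)
  open import Relation.Binary.Reasoning.Setoid setoid

  sum : ∀ {k} → (Fin k → Carrier) → Carrier
  sum = sumFin R _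

  product : ∀ {k} → (Fin k → Carrier) → Carrier
  product = prodFin R _

  module ∑ = Folds +-commutativeMonoid (sumFin R) (λ _ → ≡.refl) (λ _ _ → ≡.refl)
  module ∏ = Folds *-commutativeMonoid (prodFin R) (λ _ → ≡.refl) (λ _ _ → ≡.refl)

  sum-*ˡ : ∀ k c (f : Fin k → Carrier) → sum (λ i → c * f i) ≈ c * sum f
  sum-*ˡ _ c f = trans (reflexive (∑.≡sum (λ i → c * f i)))
    (trans (sym (*-distribˡ-sum c f)) (*-congˡ (reflexive (≡.sym (∑.≡sum f)))))

  sum-*ʳ : ∀ k c (f : Fin k → Carrier) → sum (λ i → f i * c) ≈ sum f * c
  sum-*ʳ _ c f = trans (reflexive (∑.≡sum (λ i → f i * c)))
    (trans (sym (*-distribʳ-sum c f)) (*-congʳ (reflexive (≡.sym (∑.≡sum f)))))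

  State : ℕ → Set
  State k = Fin k → Fin q

  stateSum : (k : ℕ) → (State k → Carrier) → Carrier
  stateSum k = sumStates R k q

  -- Observables that see a state only through its values.  Without function
  -- extensionality, this is what rearranging the sites of a state requires.
  Extensional : ∀ {k} → (State k → Carrier) → Set
  Extensional F = ∀ {σ σ′} → σ ≗ σ′ → F σ ≈ F σ′

  restrict : ∀ {k} (a b : Fin k) → (State k → Carrier) → State k → Carrier
  restrict a b F σ = if does (σ a ≟ σ b) then F σ else 0#

  restrict-ext : ∀ {k} (a b : Fin k) {F : State k → Carrier} →
    Extensional F → Extensional (restrict a b F)
  restrict-ext a b F-ext {σ} {σ′} σ≗σ′ rewrite σ≗σ′ a | σ≗σ′ b with does (σ′ a ≟ σ′ b)
  ... | true  = F-ext σ≗σ′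
  ... | false = refl

  stateSum-cong : ∀ k {f g : State k → Carrier} → (∀ σ → f σ ≈ g σ) → stateSum k f ≈ stateSum k g
  stateSum-cong zero    f≈g = f≈g []
  stateSum-cong (suc k) f≈g = ∑.cong q (λ a → stateSum-cong k (λ σ → f≈g (a ∷ σ)))

  stateSum-+ : ∀ k (f g : State k → Carrier) →
    stateSum k (λ σ → f σ + g σ) ≈ stateSum k f + stateSum k g
  stateSum-+ zero    f g = refl
  stateSum-+ (suc k) f g =
    trans (∑.cong q (λ a → stateSum-+ k (f ∘ (a ∷_)) (g ∘ (a ∷_)))) (∑.distrib q _ _)

  stateSum-*ˡ : ∀ k c (f : State k → Carrier) → stateSum k (λ σ → c * f σ) ≈ c * stateSum k f
  stateSum-*ˡ zero    c f = refl
  stateSum-*ˡ (suc k) c f =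
    trans (∑.cong q (λ a → stateSum-*ˡ k c (f ∘ (a ∷_)))) (sum-*ˡ q c _)

  stateSum-comm : ∀ k (H : Fin q → State k → Carrier) →
    stateSum k (λ σ → sum (λ x → H x σ)) ≈ sum (λ x → stateSum k (H x))
  stateSum-comm zero    H = refl
  stateSum-comm (suc k) H =
    trans (∑.cong q (λ a → stateSum-comm k (λ x σ → H x (a ∷ σ)))) (∑.swap q q _)

  stateSum-factorise : ∀ k (h : Fin k → Fin q → Carrier) →
    stateSum k (λ σ → product (λ j → h j (σ j))) ≈ product (λ j → sum (h j))
  stateSum-factorise zero    h = refl
  stateSum-factorise (suc k) h = begin
    sum (λ a → stateSum k (λ σ → h zero a * product (λ j → h (suc j) (σ j))))
      ≈⟨ ∑.cong q (λ a → stateSum-*ˡ k (h zero a) _) ⟩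
    sum (λ a → h zero a * stateSum k (λ σ → product (λ j → h (suc j) (σ j))))
      ≈⟨ ∑.cong q (λ a → *-congˡ (stateSum-factorise k (h ∘ suc))) ⟩
    sum (λ a → h zero a * product (λ j → sum (h (suc j))))
      ≈⟨ sum-*ʳ q _ (h zero) ⟩
    sum (h zero) * product (λ j → sum (h (suc j))) ∎

  stateSum-insertAt : ∀ {k} (b : Fin (suc k)) {F : State (suc k) → Carrier} → Extensional F →
    stateSum (suc k) F ≈ sum (λ x → stateSum k (λ τ → F (insertAt τ b x)))
  stateSum-insertAt {k} zero F-ext =
    ∑.cong q (λ x → stateSum-cong k (λ τ → F-ext λ { zero → ≡.refl ; (suc j) → ≡.refl }))
  stateSum-insertAt {suc k} (suc b) {F} F-ext = begin
    sum (λ a → stateSum (suc k) (F ∘ (a ∷_)))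
      ≈⟨ ∑.cong q (λ a → stateSum-insertAt b (F-ext ∘ ∷-cong a)) ⟩
    sum (λ a → sum (λ x → stateSum k (λ τ → F (a ∷ insertAt τ b x))))
      ≈⟨ ∑.swap q q _ ⟩
    sum (λ x → sum (λ a → stateSum k (λ τ → F (a ∷ insertAt τ b x))))
      ≈⟨ ∑.cong q (λ x → ∑.cong q (λ a → stateSum-cong k (λ τ →
           F-ext λ { zero → ≡.refl ; (suc j) → ≡.refl }))) ⟩
    sum (λ x → stateSum (suc k) (λ τ → F (insertAt τ (suc b) x))) ∎
    where
    ∷-cong : ∀ {l} a {σ σ′ : State l} → σ ≗ σ′ → (a ∷ σ) ≗ (a ∷ σ′)
    ∷-cong a σ≗σ′ zero    = ≡.refl
    ∷-cong a σ≗σ′ (suc j) = σ≗σ′ j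

  -- Summing over the states with σ a = σ b is summing over the states of the
  -- glued sites.  For a ≠ b: sum σ b last; only σ b = σ a survives.
  stateSum-glue : ∀ {k} (a b : Fin k) {F : State k → Carrier} → Extensional F →
    stateSum k (restrict a b F) ≈ stateSum (proj₁ (glue a b)) (λ τ → F (τ ∘ proj₂ (glue a b)))
  stateSum-glue {suc k} a b {F} F-ext with a ≟ b
  ... | yes ≡.refl = stateSum-cong (suc k) (λ σ →
          reflexive (≡.cong (λ d → if d then F σ else 0#) (dec-true (σ a ≟ σ a) ≡.refl)))
  ... | no a≢b = begin
    stateSum (suc k) (restrict a b F)
      ≈⟨ stateSum-insertAt b (restrict-ext a b F-ext) ⟩
    sum (λ x → stateSum k (λ τ → restrict a b F (insertAt τ b x)))
      ≈⟨ stateSum-comm k _ ⟨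
    stateSum k (λ τ → sum (λ x → restrict a b F (insertAt τ b x)))
      ≈⟨ stateSum-cong k only-σb≡σa ⟩
    stateSum k (λ τ → F (τ ∘ merge b a′)) ∎
    where
    a′ : Fin k
    a′ = punchOut (a≢b ∘ ≡.sym)

    σa≡τa′ : ∀ τ x → insertAt τ b x a ≡ τ a′
    σa≡τa′ τ x = ≡.trans (≡.cong (insertAt τ b x) (≡.sym (punchIn-punchOut (a≢b ∘ ≡.sym))))
                         (insertAt-punchIn τ b x a′)

    only-σb≡σa : ∀ τ → sum (λ x → restrict a b F (insertAt τ b x)) ≈ F (τ ∘ merge b a′)
    only-σb≡σa τ = begin
      sum (λ x → restrict a b F (insertAt τ b x))
        ≈⟨ ∑.cong q (λ x → reflexive (≡.cong₂ (λ u v → if does (u ≟ v) then F (insertAt τ b x) else 0#)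
             (σa≡τa′ τ x) (insertAt-lookup τ b x))) ⟩
      sum (λ x → if does (τ a′ ≟ x) then F (insertAt τ b x) else 0#)
        ≈⟨ ∑.select (τ a′) (λ x → F (insertAt τ b x)) ⟩
      F (insertAt τ b (τ a′))
        ≈⟨ F-ext (insertAt-map τ id b a′) ⟩
      F (τ ∘ merge b a′) ∎

module Contraction (G : Graph) where

  Edge : ℕ → Set
  Edge k = Fin (m G) × Fin k × Fin k

  relabel : ∀ {k k′} → (Fin k → Fin k′) → Edge k → Edge k′
  relabel π (e , a , b) = e , π a , π b

  block : ∀ {k} → (Fin (n G) → Fin k) → Fin k → Vec Bool (n G)
  block g j = tabulate (λ i → does (g i ≟ j))

  ∏Poly : (k : ℕ) → (Fin k → Poly (PVar G)) → Poly (PVar G)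
  ∏Poly zero    f = one′
  ∏Poly (suc k) f = f zero ⊗ ∏Poly k (f ∘ suc)

  contractionPoly : ∀ r k → (Fin (n G) → Fin k) → Vector (Edge k) r → Poly (PVar G)
  contractionPoly zero    k g E = ∏Poly k (λ j → var (inj₂ (block g j)))
  contractionPoly (suc r) k g E =
    let (e , a , b) = E zero
        (k′ , π)   = glue a b
    in contractionPoly r k g (tail E)
       ⊕ (var (inj₁ e) ⊗ contractionPoly r k′ (π ∘ g) (map (relabel π) (tail E)))

module Correctness (R : CommutativeRing 0ℓ 0ℓ) (q : ℕ) (G : Graph)
  (w : Fin (m G) → CommutativeRing.Carrier R)
  (y : Fin (n G) → Fin q → CommutativeRing.Carrier R) where
  open CommutativeRing R hiding (zero)
  open StateSums R q
  open Contraction G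
  open import Relation.Binary.Reasoning.Setoid setoid

  ρ : PVar G → Carrier
  ρ = valuation R G q w y

  edgeFactor : ∀ {k} → State k → Edge k → Carrier
  edgeFactor σ (e , a , b) = if does (σ a ≟ σ b) then w e else 1#

  weight : ∀ {r k} → (Fin (n G) → Fin k) → Vector (Edge k) r → State k → Carrier
  weight g E σ = product (λ t → edgeFactor σ (E t)) * product (λ i → y i (σ (g i)))

  ZC : ∀ {r k} → (Fin (n G) → Fin k) → Vector (Edge k) r → Carrier
  ZC {k = k} g E = stateSum k (weight g E)

  weight-ext : ∀ {r k} (g : Fin (n G) → Fin k) (E : Vector (Edge k) r) → Extensional (weight g E)
  weight-ext g E {σ} {σ′} σ≗σ′ = *-cong
    (∏.cong _ (λ t → reflexive (edgeFactor-ext (E t))))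
    (∏.cong _ (λ i → reflexive (≡.cong (y i) (σ≗σ′ (g i)))))
    where
    edgeFactor-ext : ∀ ε → edgeFactor σ ε ≡ edgeFactor σ′ ε
    edgeFactor-ext (e , a , b) rewrite σ≗σ′ a | σ≗σ′ b = ≡.refl

  -- With w = 1 + v: (1 + v δ) X = X + v (δ X).
  edge-split : ∀ (d : Bool) W X → (if d then W else 1#) * X ≈ X + (W - 1#) * (if d then X else 0#)
  edge-split true  W X = begin
    W * X                   ≈⟨ *-congʳ W≈1+[W-1] ⟩
    (1# + (W - 1#)) * X     ≈⟨ distribʳ X 1# (W - 1#) ⟩
    1# * X + (W - 1#) * X   ≈⟨ +-congʳ (*-identityˡ X) ⟩
    X + (W - 1#) * X        ∎
    where
    W≈1+[W-1] : W ≈ 1# + (W - 1#)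
    W≈1+[W-1] = sym (begin
      1# + (W - 1#)    ≈⟨ +-congˡ (+-comm W (- 1#)) ⟩
      1# + (- 1# + W)  ≈⟨ +-assoc 1# (- 1#) W ⟨
      (1# - 1#) + W    ≈⟨ +-congʳ (-‿inverseʳ 1#) ⟩
      0# + W           ≈⟨ +-identityˡ W ⟩
      W                ∎)
  edge-split false W X = begin
    1# * X                ≈⟨ *-identityˡ X ⟩
    X                     ≈⟨ +-identityʳ X ⟨
    X + 0#                ≈⟨ +-congˡ (zeroʳ (W - 1#)) ⟨
    X + (W - 1#) * 0#     ∎

  deletion-contraction : ∀ {r k} (g : Fin (n G) → Fin k) e (a b : Fin k) (E : Vector (Edge k) r) →
    let (k′ , π) = glue a b in
    ZC g ((e , a , b) ∷ E) ≈ ZC g E + vVar R G w e * ZC (π ∘ g) (map (relabel π) E)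
  deletion-contraction {k = k} g e a b E = begin
    stateSum k (λ σ → (edgeFactor σ (e , a , b) * product (λ t → edgeFactor σ (E t))) * Y σ)
      ≈⟨ stateSum-cong k (λ σ → trans (*-assoc _ _ _) (edge-split (does (σ a ≟ σ b)) (w e) (weight g E σ))) ⟩
    stateSum k (λ σ → weight g E σ + (w e - 1#) * restrict a b (weight g E) σ)
      ≈⟨ stateSum-+ k _ _ ⟩
    ZC g E + stateSum k (λ σ → (w e - 1#) * restrict a b (weight g E) σ)
      ≈⟨ +-congˡ (stateSum-*ˡ k _ _) ⟩
    ZC g E + (w e - 1#) * stateSum k (restrict a b (weight g E))
      ≈⟨ +-congˡ (*-congˡ (stateSum-glue a b (weight-ext g E))) ⟩
    ZC g E + (w e - 1#) * stateSum (proj₁ (glue a b)) (λ τ → weight g E (τ ∘ proj₂ (glue a b))) ∎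
    where
    Y : State k → Carrier
    Y σ = product (λ i → y i (σ (g i)))

  eval-∏Poly : ∀ k (f : Fin k → Poly (PVar G)) → eval R ρ (∏Poly k f) ≈ product (λ j → eval R ρ (f j))
  eval-∏Poly zero    f = refl
  eval-∏Poly (suc k) f = *-congˡ (eval-∏Poly k (f ∘ suc))

  -- Without edges, vertex i contributes y_i at the spin of its block; grouping
  -- the vertices by block, each block j contributes X of its indicator vector.
  no-edges : ∀ {k} (g : Fin (n G) → Fin k) (E : Vector (Edge k) zero) →
    ZC g E ≈ eval R ρ (contractionPoly zero k g E)
  no-edges {k} g E = begin
    stateSum k (λ σ → 1# * product (λ i → y i (σ (g i))))
      ≈⟨ stateSum-cong k (λ σ → trans (*-identityˡ _) (group-by-block σ)) ⟩
    stateSum k (λ σ → product (λ j → blockWeight j (σ j)))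
      ≈⟨ stateSum-factorise k blockWeight ⟩
    product (λ j → sum (blockWeight j))
      ≈⟨ ∏.cong k (λ j → ∑.cong q (λ α → ∏.cong (n G) (λ i →
           reflexive (≡.cong (λ d → if d then y i α else 1#) (≡.sym (lookup∘tabulate _ i)))))) ⟩
    product (λ j → eval R ρ (var (inj₂ (block g j))))
      ≈⟨ eval-∏Poly k _ ⟨
    eval R ρ (contractionPoly zero k g E) ∎
    where
    blockWeight : Fin k → Fin q → Carrier
    blockWeight j α = product (λ i → if does (g i ≟ j) then y i α else 1#)

    group-by-block : ∀ σ → product (λ i → y i (σ (g i))) ≈ product (λ j → blockWeight j (σ j))
    group-by-block σ = trans (∏.cong (n G) (λ i → sym (∏.select (g i) (λ j → y i (σ j)))))
                             (∏.swap (n G) k _)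

  contractionPoly-correct : ∀ r k (g : Fin (n G) → Fin k) (E : Vector (Edge k) r) →
    ZC g E ≈ eval R ρ (contractionPoly r k g E)
  contractionPoly-correct zero    k g E = no-edges g E
  contractionPoly-correct (suc r) k g E =
    let (e , a , b) = E zero
        (k′ , π)   = glue a b
    in trans (deletion-contraction g e a b (tail E))
             (+-cong (contractionPoly-correct r k g (tail E))
                     (*-congˡ (contractionPoly-correct r k′ (π ∘ g) (map (relabel π) (tail E)))))

-- Corollary 4.4: Z(G) is the value of an integer polynomial in the v_e and the
-- X_M.  G itself is the contraction with one block per vertex.
corollary4p4 : (q : ℕ) → 1 ≤ q → (G : Graph) → Connected G →
    Σ (Poly (PVar G)) λ P →
      (R : CommutativeRing 0ℓ 0ℓ) →
      (w : Fin (m G) → CommutativeRing.Carrier R) →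
      (y : Fin (n G) → Fin q → CommutativeRing.Carrier R) →
      CommutativeRing._≈_ R (Z R G q w y) (eval R (valuation R G q w y) P)
corollary4p4 q _ G _ =
  Contraction.contractionPoly G (m G) (n G) id edges ,
  λ R w y → Correctness.contractionPoly-correct R q G w y (m G) (n G) id edges
  where
  edges : Vector (Contraction.Edge G (n G)) (m G)
  edges e = e , ends G e
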